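{- Let $m\geq 0$ be an integer. For each $q\vdash m$, $$\sum_{p\vdash m}(-1)^{|[p]|}\binom{|[p]|}{[p]}N(p,q)\;=\;(-1)^m,$$ and $$\sum_{p\vdash m}\sum_{q\vdash m}(-1)^{|[p]|+|[q]|}\binom{|[p]|}{[p]}\binom{|[q]|}{[q]}N(p,q)\;=\;\frac{1^{\underline{m}}}{m!},$$ where the right-hand side of the second identity equals $1$ if $m\le 1$ and $0$ if $m>1$.
   Context: Sequences $p=(p_1,p_2,\dots)$ are sequences of non-negative integers with finitely many non-zero entries. Set $|p|=\sum_{i\geq1}p_i$ and $[p]=(\#\{j:p_j=i\})_{i\geq1}$; thus $|[p]|$ is the number of non-zero entries of $p$. Write $[p]!=\prod_{i\ge1}(\#\{j:p_j=i\})!$, and $\binom{|[p]|}{[p]}=\frac{|[p]|!}{[p]!}$ is the multinomial coefficient. For $x\in\mathbb R$ and integer $l\ge0$, $x^{\underline{l}}=x(x-1)\cdots(x-l+1)$ (with $x^{\underline 0}=1$). We write $p\vdash m$ if $|p|=m$ and $p_1\geq p_2\geq\cdots$. For $p,q\vdash m$, $N(p,q)$ denotes the number of $|[p]|\times|[q]|$ matrices with entries in $\{0,1\}$ whose row sums are $p_1,\dots,p_{|[p]|}$ and whose column sums are $q_1,\dots,q_{|[q]|}$; for $m=0$, $N(p,q)$ is interpreted as $1$. -}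

module Defs where

open import Data.Bool using (Bool; true; false)
open import Data.Nat using (ℕ; zero; suc; _+_; _*_; _≥_; _!; NonZero; _≟_; _/_)
open import Data.Nat.Properties using (_!≢0; m*n≢0)
open import Data.List as L using (List; []; _∷_; length; filter; applyUpTo; concatMap)
open import Data.Nat.ListAction using (sum)
open import Data.List.Properties using (≡-dec)
open import Data.List.Relation.Unary.All using (All)
open import Data.List.Relation.Unary.Linked using (Linked)
open import Data.Vec as V using (Vec; []; _∷_; toList; transpose)
open import Data.Product using (_×_; _,_)
open import Relation.Binary.PropositionalEquality using (_≡_)
open import Relation.Nullary using (Dec)
open import Relation.Nullary.Decidable using (_×-dec_)
open import Data.Integer as ℤ using (ℤ)

-- A partition p ⊢ m, represented by the list of its non-zero entries
-- p₁ ≥ p₂ ≥ ... ≥ p_k > 0 (all later entries of the sequence are 0).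
_⊢_ : List ℕ → ℕ → Set
p ⊢ m = (sum p ≡ m) × All (λ x → NonZero x) p × Linked _≥_ p

numParts : List ℕ → ℕ
numParts = length

mult : ℕ → List ℕ → ℕ
mult i p = length (filter (λ x → x ≟ i) p)

prodFact : List ℕ → ℕ
prodFact []       = 1
prodFact (x ∷ xs) = (x !) * prodFact xs

prodFact≢0 : ∀ xs → NonZero (prodFact xs)
prodFact≢0 []       = _
prodFact≢0 (x ∷ xs) = m*n≢0 (x !) (prodFact xs) {{x !≢0}} {{prodFact≢0 xs}}

-- [p]! = ∏_{i ≥ 1} (#{j : p_j = i})!   (i ranges over 1..|p|; larger i have multiplicity 0)
bracketFact : List ℕ → ℕ
bracketFact p = prodFact (applyUpTo (λ k → mult (suc k) p) (sum p))

multinom : List ℕ → ℕ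
multinom p = ((numParts p) ! / bracketFact p) {{prodFact≢0 (applyUpTo (λ k → mult (suc k) p) (sum p))}}

allVecs : (n : ℕ) → List (Vec Bool n)
allVecs zero    = [] ∷ []
allVecs (suc n) = concatMap (λ v → (false ∷ v) ∷ (true ∷ v) ∷ []) (allVecs n)

allMats : (r c : ℕ) → List (Vec (Vec Bool c) r)
allMats zero    c = [] ∷ []
allMats (suc r) c = concatMap (λ row → L.map (λ M → row ∷ M) (allMats r c)) (allVecs c)

countTrue : ∀ {n} → Vec Bool n → ℕ
countTrue []           = 0
countTrue (true ∷ v)   = suc (countTrue v)
countTrue (false ∷ v)  = countTrue v

rowSums : ∀ {r c} → Vec (Vec Bool c) r → List ℕ
rowSums M = toList (V.map countTrue M)

colSums : ∀ {r c} → Vec (Vec Bool c) r → List ℕ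
colSums {r} {c} M = rowSums (transpose M)

N : List ℕ → List ℕ → ℕ
N p q = length (filter (λ M → ≡-dec _≟_ (rowSums M) p ×-dec ≡-dec _≟_ (colSums M) q)
                       (allMats (length p) (length q)))

sgn : ℕ → ℤ
sgn zero          = ℤ.+ 1
sgn (suc zero)    = ℤ.- (ℤ.+ 1)
sgn (suc (suc k)) = sgn k

fall : ℕ → ℕ → ℕ
fall x zero    = 1
fall x (suc l) = fall x l * (x Data.Nat.∸ l)

sumℤ : List ℤ → ℤ
sumℤ = L.foldr ℤ._+_ (ℤ.+ 0)

module Submission where

open import Defs
open import Data.Nat as ℕ using (ℕ; _!; _/_)
open import Data.Nat.Properties using (_!≢0)
open import Data.Integer as ℤ using (ℤ)
open import Data.List as L using (List)
open import Data.List.Membership.Propositional using (_∈_)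
open import Data.List.Relation.Unary.Unique.Propositional using (Unique)
open import Data.Product using (_×_)
open import Relation.Binary.PropositionalEquality using (_≡_)

open import Algebra.Bundles using (CommutativeSemiring; CommutativeMonoid)
open import Data.Bool using (Bool; true; false; _∧_; if_then_else_)
open import Data.Empty using (⊥-elim)
open import Data.List using ([]; _∷_; _++_; _∷ʳ_; length; filter; map; foldr; concatMap; applyUpTo)
open import Data.List.Properties using (≡-dec)
open import Data.Nat using (zero; suc; _∸_; _≤_; _<_; _≥_; _≤?_; _≟_; s≤s; z≤n; NonZero)
import Data.Nat.Properties as ℕP
open import Data.Nat.ListAction using (sum)
open import Data.Nat.ListAction.Properties using (sum-↭)
open import Data.List.Membership.DecPropositional _≟_ using (_∉_; _∈?_)
open import Data.List.Relation.Binary.Permutation.Propositional as ↭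
  using (_↭_; ↭-refl; ↭-prep; ↭-swap; ↭-trans; ↭-sym)
open import Data.List.Relation.Binary.Permutation.Propositional.Properties
  using (↭-length; filter-↭; All-resp-↭; Any-resp-↭)
open import Data.List.Relation.Unary.All as All using (All; []; _∷_)
open import Data.List.Relation.Unary.AllPairs using (AllPairs; []; _∷_)
open import Data.List.Relation.Unary.Any using (here; there)
open import Data.List.Relation.Unary.Linked using (Linked; [])
open import Data.Product using (_,_; proj₁; proj₂)
open import Data.Sum using (_⊎_; inj₁; inj₂)
open import Data.Vec as V using (Vec; []; _∷_)
open import Function using (_∘_)
open import Induction.WellFounded using (Acc; acc)
open import Data.Nat.Induction using (<-wellFounded)
open import Relation.Nullary using (Dec; does; yes; no; ¬_)
open import Relation.Nullary.Decidable using (dec-true; dec-false; _×-dec_)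
open import Relation.Unary using (Pred; Decidable)
open import Relation.Binary.PropositionalEquality
  using (_≢_; refl; sym; trans; cong; cong₂; subst; subst₂; module ≡-Reasoning)

-- Write c(p) = (-1)^|[p]| |[p]|!/[p]!.  Deleting one copy of a part v from p gives
-- the multinomial recurrence c(p) = -Σ_{v ∈ p} c(p - v), and N(p,q) does not depend on
-- the order of the rows, so N(p,q) = N(v ∷ (p - v), q).  Hence for such symmetric f,
-- Σ_{p ⊢ m} c(p) f(p) = -Σ_{v=1..m} Σ_{p' ⊢ m-v} c(p') f(v ∷ p').  For f = N(·,q) we
-- count the matrices by their first row r, a 0-1 row with v ones lying below q; by
-- induction on m this leaves -(-1)^m Σ_{r ≠ 0 below q} (-1)^|r| = (-1)^m, the last sum
-- being (1 - 1)^k - 1 with k ≥ 1 the number of non-zero entries of q.  For f = 1 the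
-- same splitting shows that Σ_{p ⊢ m} c(p) is the coefficient of x^m in
-- Σ_k (-x/(1-x))^k = 1 - x, and summing the first identity against c(q) gives the
-- double sum as (-1)^m times that coefficient.

oneTo : ℕ → List ℕ
oneTo zero    = []
oneTo (suc B) = suc B ∷ oneTo B

∈-oneTo⁻ : ∀ {v B} → v ∈ oneTo B → 1 ≤ v × v ≤ B
∈-oneTo⁻ {B = suc B} (here refl) = s≤s z≤n , ℕP.≤-refl
∈-oneTo⁻ {B = suc B} (there v∈) with ∈-oneTo⁻ v∈
... | 1≤v , v≤B = 1≤v , ℕP.m≤n⇒m≤1+n v≤B

∈-oneTo⁺ : ∀ {v B} → 1 ≤ v → v ≤ B → v ∈ oneTo B
∈-oneTo⁺ {suc v} {zero} _ ()
∈-oneTo⁺ {v} {suc B} 1≤v v≤1+B with v ≟ suc B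
... | yes refl = here refl
... | no v≢1+B = there (∈-oneTo⁺ 1≤v (ℕP.≤-pred (ℕP.≤∧≢⇒< v≤1+B v≢1+B)))

module ListSum {c ℓ} (R : CommutativeSemiring c ℓ) where

  open CommutativeSemiring R renaming (refl to ≈-refl; sym to ≈-sym; trans to ≈-trans)
  open import Algebra.Properties.CommutativeSemigroup +-commutativeSemigroup using (interchange)
  open import Relation.Binary.Reasoning.Setoid setoid

  ∑ : {A : Set} → List A → (A → Carrier) → Carrier
  ∑ xs f = foldr _+_ 0# (map f xs)

  infix 5 ∑
  syntax ∑ xs (λ x → e) = ∑[ x ∈ xs ] e

  private variable A B : Set

  ∑-cong : (xs : List A) {f g : A → Carrier} → (∀ {x} → x ∈ xs → f x ≈ g x) → ∑ xs f ≈ ∑ xs g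
  ∑-cong []       f≈g = ≈-refl
  ∑-cong (x ∷ xs) f≈g = +-cong (f≈g (here refl)) (∑-cong xs (f≈g ∘ there))

  ∑-++ : (xs ys : List A) (f : A → Carrier) → ∑ (xs ++ ys) f ≈ ∑ xs f + ∑ ys f
  ∑-++ []       ys f = ≈-sym (+-identityˡ _)
  ∑-++ (x ∷ xs) ys f = ≈-trans (+-congˡ (∑-++ xs ys f)) (≈-sym (+-assoc _ _ _))

  ∑-concatMap : (xs : List A) (g : A → List B) (f : B → Carrier) →
                ∑ (concatMap g xs) f ≈ ∑[ x ∈ xs ] ∑ (g x) f
  ∑-concatMap []       g f = ≈-refl
  ∑-concatMap (x ∷ xs) g f = ≈-trans (∑-++ (g x) _ f) (+-congˡ (∑-concatMap xs g f))

  ∑-map : (xs : List A) (g : A → B) (f : B → Carrier) → ∑ (map g xs) f ≈ ∑ xs (f ∘ g)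
  ∑-map []       g f = ≈-refl
  ∑-map (x ∷ xs) g f = +-congˡ (∑-map xs g f)

  ∑-zero : (xs : List A) → ∑[ x ∈ xs ] 0# ≈ 0#
  ∑-zero []       = ≈-refl
  ∑-zero (x ∷ xs) = ≈-trans (+-identityˡ _) (∑-zero xs)

  ∑-+ : (xs : List A) (f g : A → Carrier) → ∑[ x ∈ xs ] (f x + g x) ≈ ∑ xs f + ∑ xs g
  ∑-+ []       f g = ≈-sym (+-identityˡ 0#)
  ∑-+ (x ∷ xs) f g = ≈-trans (+-congˡ (∑-+ xs f g)) (interchange _ _ _ _)

  ∑-distribˡ : (a : Carrier) (xs : List A) (f : A → Carrier) → a * ∑ xs f ≈ ∑[ x ∈ xs ] (a * f x)
  ∑-distribˡ a []       f = zeroʳ a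
  ∑-distribˡ a (x ∷ xs) f = ≈-trans (distribˡ a (f x) _) (+-congˡ (∑-distribˡ a xs f))

  ∑-distribʳ : (a : Carrier) (xs : List A) (f : A → Carrier) → ∑ xs f * a ≈ ∑[ x ∈ xs ] (f x * a)
  ∑-distribʳ a xs f = begin
    ∑ xs f * a            ≈⟨ *-comm _ a ⟩
    a * ∑ xs f            ≈⟨ ∑-distribˡ a xs f ⟩
    ∑[ x ∈ xs ] (a * f x) ≈⟨ ∑-cong xs (λ _ → *-comm a _) ⟩
    ∑[ x ∈ xs ] (f x * a) ∎

  ∑-comm : (xs : List A) (ys : List B) (f : A → B → Carrier) →
           ∑[ x ∈ xs ] ∑[ y ∈ ys ] f x y ≈ ∑[ y ∈ ys ] ∑[ x ∈ xs ] f x y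
  ∑-comm []       ys f = ≈-sym (∑-zero ys)
  ∑-comm (x ∷ xs) ys f = ≈-trans (+-congˡ (∑-comm xs ys f)) (≈-sym (∑-+ ys (f x) _))

  ∑-filter : ∀ {p} {P : Pred A p} (P? : Decidable P) (xs : List A) (f : A → Carrier) →
             ∑ (filter P? xs) f ≈ ∑[ x ∈ xs ] (if does (P? x) then f x else 0#)
  ∑-filter P? []       f = ≈-refl
  ∑-filter P? (x ∷ xs) f with does (P? x)
  ... | true  = +-congˡ (∑-filter P? xs f)
  ... | false = ≈-trans (∑-filter P? xs f) (≈-sym (+-identityˡ _))

  ∑-oneTo-single : ∀ B {k} (g : ℕ → Carrier) → (∀ {v} → v ≢ k → g v ≈ 0#) → 1 ≤ k → k ≤ B →
                   ∑ (oneTo B) g ≈ g k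
  ∑-oneTo-single zero    {suc k} g g≈0 1≤k ()
  ∑-oneTo-single (suc B) {k} g g≈0 1≤k k≤1+B with k ≟ suc B
  ... | yes refl = begin
    g k + ∑ (oneTo B) g         ≈⟨ +-congˡ (∑-cong (oneTo B) (g≈0 ∘ v≤B⇒v≢1+B ∘ ∈-oneTo⁻)) ⟩
    g k + (∑[ v ∈ oneTo B ] 0#) ≈⟨ +-congˡ (∑-zero (oneTo B)) ⟩
    g k + 0#                    ≈⟨ +-identityʳ (g k) ⟩
    g k                         ∎
    where
    v≤B⇒v≢1+B : ∀ {v} → 1 ≤ v × v ≤ B → v ≢ suc B
    v≤B⇒v≢1+B (_ , v≤B) refl = ℕP.<-irrefl refl v≤B
  ... | no k≢1+B = ≈-trans (+-cong (g≈0 (k≢1+B ∘ sym)) ≈-refl)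
    (≈-trans (+-identityˡ _) (∑-oneTo-single B g g≈0 1≤k (ℕP.≤-pred (ℕP.≤∧≢⇒< k≤1+B k≢1+B))))

module ℕ∑ = ListSum ℕP.+-*-commutativeSemiring

module Multiplicities where

  open import Data.Nat using (_+_; _*_)
  open import Data.List.Properties using (filter-accept; filter-reject; filter-++; length-++; applyUpTo-∷ʳ)
  open import Data.List.Relation.Unary.All.Properties using (All¬⇒¬Any)
  open import Data.Nat.DivMod using (m*n/n≡m)
  open import Algebra.Properties.CommutativeSemigroup ℕP.*-commutativeSemigroup using (x∙yz≈y∙xz)
  open ≡-Reasoning

  delete : ℕ → List ℕ → List ℕ
  delete v [] = []
  delete v (x ∷ xs) with v ≟ x
  ... | yes _ = xs
  ... | no  _ = x ∷ delete v xs

  delete-↭ : ∀ {v p} → v ∈ p → p ↭ v ∷ delete v p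
  delete-↭ {v} {x ∷ xs} v∈ with v ≟ x
  delete-↭ {v} {x ∷ xs} v∈          | yes refl = ↭-refl
  delete-↭ {v} {x ∷ xs} (here v≡x)  | no v≢x   = ⊥-elim (v≢x v≡x)
  delete-↭ {v} {x ∷ xs} (there v∈)  | no v≢x   = ↭-trans (↭-prep x (delete-↭ v∈)) (↭-swap x v ↭-refl)

  delete-here : ∀ v xs → delete v (v ∷ xs) ≡ xs
  delete-here v xs with v ≟ v
  ... | yes _   = refl
  ... | no v≢v  = ⊥-elim (v≢v refl)

  delete-there : ∀ {v x} xs → v ≢ x → delete v (x ∷ xs) ≡ x ∷ delete v xs
  delete-there {v} {x} xs v≢x with v ≟ x
  ... | yes v≡x = ⊥-elim (v≢x v≡x)
  ... | no _    = refl

  All-delete : ∀ {P : ℕ → Set} {v p} → All P p → All P (delete v p)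
  All-delete {p = []}     []         = []
  All-delete {v = v} {x ∷ xs} (Px ∷ Pxs) with v ≟ x
  ... | yes _ = Pxs
  ... | no _  = Px ∷ All-delete Pxs

  AllPairs-delete : ∀ {R : ℕ → ℕ → Set} {v p} → AllPairs R p → AllPairs R (delete v p)
  AllPairs-delete {p = []}     []           = []
  AllPairs-delete {v = v} {x ∷ xs} (Rxs ∷ Rxs*) with v ≟ x
  ... | yes _ = Rxs*
  ... | no _  = All-delete Rxs ∷ AllPairs-delete Rxs*

  mult-↭ : ∀ i {p p'} → p ↭ p' → mult i p ≡ mult i p'
  mult-↭ i σ = ↭-length (filter-↭ (λ x → x ≟ i) σ)

  mult-here : ∀ i xs → mult i (i ∷ xs) ≡ suc (mult i xs)
  mult-here i xs = cong length (filter-accept (λ x → x ≟ i) refl)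

  mult-there : ∀ {i x} xs → x ≢ i → mult i (x ∷ xs) ≡ mult i xs
  mult-there {i} xs x≢i = cong length (filter-reject (λ x → x ≟ i) x≢i)

  mult-∷ : ∀ i x xs → mult i (x ∷ xs) ≡ mult i (x ∷ []) + mult i xs
  mult-∷ i x xs = trans (cong length (filter-++ (_≟ i) (x ∷ []) xs)) (length-++ (filter (_≟ i) (x ∷ [])))

  ∉⇒mult≡0 : ∀ {v p} → v ∉ p → mult v p ≡ 0
  ∉⇒mult≡0 {p = []}     _  = refl
  ∉⇒mult≡0 {p = x ∷ xs} v∉ =
    trans (mult-there xs (λ x≡v → v∉ (here (sym x≡v)))) (∉⇒mult≡0 (v∉ ∘ there))

  mult-delete-self : ∀ {v p} → v ∈ p → mult v p ≡ suc (mult v (delete v p))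
  mult-delete-self {v} v∈ = trans (mult-↭ v (delete-↭ v∈)) (mult-here v _)

  mult-delete-other : ∀ {i v p} → i ≢ v → v ∈ p → mult i (delete v p) ≡ mult i p
  mult-delete-other {i} i≢v v∈ = sym (trans (mult-↭ i (delete-↭ v∈)) (mult-there _ (i≢v ∘ sym)))

  ∑-mult : ∀ B p → All (_∈ oneTo B) p → ℕ∑.∑[ v ∈ oneTo B ] mult v p ≡ length p
  ∑-mult B []       []          = ℕ∑.∑-zero (oneTo B)
  ∑-mult B (x ∷ xs) (x∈ ∷ xs∈) with ∈-oneTo⁻ x∈
  ... | 1≤x , x≤B = begin
    ℕ∑.∑[ v ∈ oneTo B ] mult v (x ∷ xs)
      ≡⟨ ℕ∑.∑-cong (oneTo B) (λ {v} _ → mult-∷ v x xs) ⟩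
    ℕ∑.∑[ v ∈ oneTo B ] (mult v (x ∷ []) + mult v xs)
      ≡⟨ ℕ∑.∑-+ (oneTo B) _ _ ⟩
    (ℕ∑.∑[ v ∈ oneTo B ] mult v (x ∷ [])) + (ℕ∑.∑[ v ∈ oneTo B ] mult v xs)
      ≡⟨ cong₂ _+_ (ℕ∑.∑-oneTo-single B (λ v → mult v (x ∷ [])) (mult-there [] ∘ (_∘ sym)) 1≤x x≤B)
                   (∑-mult B xs xs∈) ⟩
    mult x (x ∷ []) + length xs
      ≡⟨ cong (_+ length xs) (mult-here x []) ⟩
    suc (length xs) ∎

  multFact : ℕ → List ℕ → ℕ
  multFact zero    p = 1
  multFact (suc B) p = mult (suc B) p ! * multFact B p

  multFact-cong : ∀ B {p p'} → (∀ {i} → i ∈ oneTo B → mult i p ≡ mult i p') → multFact B p ≡ multFact B p'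
  multFact-cong zero    _     = refl
  multFact-cong (suc B) mult≡ = cong₂ _*_ (cong _! (mult≡ (here refl))) (multFact-cong B (mult≡ ∘ there))

  multFact-[] : ∀ B → multFact B [] ≡ 1
  multFact-[] zero    = refl
  multFact-[] (suc B) = trans (ℕP.+-identityʳ _) (multFact-[] B)

  multFact-delete : ∀ B {v p} → v ∈ oneTo B → v ∈ p → multFact B p ≡ mult v p * multFact B (delete v p)
  multFact-delete (suc B) {v} {p} (here refl) v∈p = begin
    mult v p ! * multFact B p
      ≡⟨ cong₂ _*_ (cong _! (mult-delete-self v∈p)) (multFact-cong B unchanged) ⟩
    suc k ! * multFact B (delete v p)
      ≡⟨ ℕP.*-assoc (suc k) (k !) _ ⟩
    suc k * (k ! * multFact B (delete v p))
      ≡⟨ cong (_* (k ! * multFact B (delete v p))) (sym (mult-delete-self v∈p)) ⟩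
    mult v p * (k ! * multFact B (delete v p)) ∎
    where
    k = mult v (delete v p)
    unchanged : ∀ {i} → i ∈ oneTo B → mult i p ≡ mult i (delete v p)
    unchanged i∈ with ∈-oneTo⁻ i∈
    ... | _ , i≤B = sym (mult-delete-other (λ { refl → ℕP.<-irrefl refl i≤B }) v∈p)
  multFact-delete (suc B) {v} {p} (there v∈) v∈p = begin
    mult (suc B) p ! * multFact B p
      ≡⟨ cong₂ _*_ (cong _! (sym (mult-delete-other 1+B≢v v∈p))) (multFact-delete B v∈ v∈p) ⟩
    mult (suc B) (delete v p) ! * (mult v p * multFact B (delete v p))
      ≡⟨ x∙yz≈y∙xz (mult (suc B) (delete v p) !) (mult v p) _ ⟩
    mult v p * (mult (suc B) (delete v p) ! * multFact B (delete v p)) ∎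
    where
    1+B≢v : suc B ≢ v
    1+B≢v refl with ∈-oneTo⁻ v∈
    ... | _ , 1+B≤B = ℕP.<-irrefl refl 1+B≤B

  multFact-+ : ∀ k B p → All (_≤ B) p → multFact (k + B) p ≡ multFact B p
  multFact-+ zero    B p _   = refl
  multFact-+ (suc k) B p p≤B = begin
    mult (suc k + B) p ! * multFact (k + B) p ≡⟨ cong₂ _*_ (cong _! (∉⇒mult≡0 absent)) (multFact-+ k B p p≤B) ⟩
    1 * multFact B p                          ≡⟨ ℕP.*-identityˡ _ ⟩
    multFact B p                              ∎
    where
    absent : suc k + B ∉ p
    absent = All¬⇒¬Any (All.map (λ x≤B x≡ → ℕP.<-irrefl (sym x≡) (s≤s (ℕP.≤-trans x≤B (ℕP.m≤n+m B k))))
                                 p≤B)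

  prodFact-∷ʳ : ∀ xs x → prodFact (xs ∷ʳ x) ≡ prodFact xs * x !
  prodFact-∷ʳ []       x = trans (ℕP.*-identityʳ _) (sym (ℕP.+-identityʳ _))
  prodFact-∷ʳ (y ∷ ys) x = trans (cong (y ! *_) (prodFact-∷ʳ ys x)) (sym (ℕP.*-assoc (y !) _ _))

  prodFact-applyUpTo-mult : ∀ B p → prodFact (applyUpTo (λ k → mult (suc k) p) B) ≡ multFact B p
  prodFact-applyUpTo-mult zero    p = refl
  prodFact-applyUpTo-mult (suc B) p = begin
    prodFact (applyUpTo f (suc B))      ≡⟨ cong prodFact (sym (applyUpTo-∷ʳ f B)) ⟩
    prodFact (applyUpTo f B ∷ʳ f B)     ≡⟨ prodFact-∷ʳ (applyUpTo f B) (f B) ⟩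
    prodFact (applyUpTo f B) * f B !    ≡⟨ cong (_* f B !) (prodFact-applyUpTo-mult B p) ⟩
    multFact B p * f B !                ≡⟨ ℕP.*-comm (multFact B p) _ ⟩
    f B ! * multFact B p                ∎
    where
    f = λ k → mult (suc k) p

  -- The number of distinct orderings of p (of length n, entries in 1..B), by first entry.
  arrangements : ℕ → ℕ → List ℕ → ℕ
  arrangements zero    B p = 1
  arrangements (suc n) B p =
    ℕ∑.∑[ v ∈ oneTo B ] (if does (v ∈? p) then arrangements n B (delete v p) else 0)

  length-delete : ∀ {v p} → v ∈ p → length p ≡ suc (length (delete v p))
  length-delete v∈ = ↭-length (delete-↭ v∈)

  arrangements-*-multFact : ∀ n B p → length p ≡ n → All (_∈ oneTo B) p →
                            arrangements n B p * multFact B p ≡ n !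
  arrangements-*-multFact zero    B [] refl [] = trans (ℕP.+-identityʳ _) (multFact-[] B)
  arrangements-*-multFact (suc n) B p len p⊆B = begin
    ℕ∑.∑ (oneTo B) term * multFact B p           ≡⟨ ℕ∑.∑-distribʳ (multFact B p) (oneTo B) term ⟩
    ℕ∑.∑[ v ∈ oneTo B ] (term v * multFact B p)  ≡⟨ ℕ∑.∑-cong (oneTo B) step ⟩
    ℕ∑.∑[ v ∈ oneTo B ] (mult v p * n !)         ≡⟨ ℕ∑.∑-distribʳ (n !) (oneTo B) (λ v → mult v p) ⟨
    (ℕ∑.∑[ v ∈ oneTo B ] mult v p) * n !         ≡⟨ cong (_* n !) (trans (∑-mult B p p⊆B) len) ⟩
    suc n * n !                                  ∎
    where
    term : ℕ → ℕ
    term v = if does (v ∈? p) then arrangements n B (delete v p) else 0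
    step : ∀ {v} → v ∈ oneTo B → term v * multFact B p ≡ mult v p * n !
    step {v} v∈B with v ∈? p
    ... | no v∉p rewrite ∉⇒mult≡0 v∉p = refl
    ... | yes v∈p = begin
      a * multFact B p                           ≡⟨ cong (a *_) (multFact-delete B v∈B v∈p) ⟩
      a * (mult v p * multFact B (delete v p))   ≡⟨ x∙yz≈y∙xz a (mult v p) _ ⟩
      mult v p * (a * multFact B (delete v p))   ≡⟨ cong (mult v p *_) ih ⟩
      mult v p * n !                             ∎
      where
      a = arrangements n B (delete v p)
      ih : a * multFact B (delete v p) ≡ n !
      ih = arrangements-*-multFact n B (delete v p)
             (ℕP.suc-injective (trans (sym (length-delete v∈p)) len)) (All-delete p⊆B)

  All-≤-sum : ∀ p → All (_≤ sum p) p
  All-≤-sum []       = []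
  All-≤-sum (x ∷ xs) =
    ℕP.m≤m+n x (sum xs) ∷ All.map (λ y≤ → ℕP.≤-trans y≤ (ℕP.m≤n+m (sum xs) x)) (All-≤-sum xs)

  multinom≡arrangements : ∀ B p → All NonZero p → sum p ≤ B → multinom p ≡ arrangements (length p) B p
  multinom≡arrangements B p nz p≤B = begin
    (length p ! / bracketFact p) {{≢0}}  ≡⟨ cong (λ a → (a / bracketFact p) {{≢0}}) factorisation ⟩
    (a * bracketFact p / bracketFact p) {{≢0}} ≡⟨ m*n/n≡m a (bracketFact p) {{≢0}} ⟩
    a ∎
    where
    a = arrangements (length p) B p
    ≢0 = prodFact≢0 (applyUpTo (λ k → mult (suc k) p) (sum p))
    bracketFact≡multFact : bracketFact p ≡ multFact B p
    bracketFact≡multFact = begin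
      bracketFact p                    ≡⟨ prodFact-applyUpTo-mult (sum p) p ⟩
      multFact (sum p) p               ≡⟨ multFact-+ (B ∸ sum p) (sum p) p (All-≤-sum p) ⟨
      multFact (B ∸ sum p + sum p) p   ≡⟨ cong (λ b → multFact b p) (ℕP.m∸n+n≡m p≤B) ⟩
      multFact B p                     ∎
    p⊆B : All (_∈ oneTo B) p
    p⊆B = All.zipWith (λ (x≢0 , x≤) → ∈-oneTo⁺ (ℕ.>-nonZero⁻¹ _ {{x≢0}}) (ℕP.≤-trans x≤ p≤B))
                      (nz , All-≤-sum p)
    factorisation : length p ! ≡ a * bracketFact p
    factorisation = sym (trans (cong (a *_) bracketFact≡multFact) (arrangements-*-multFact (length p) B p refl p⊆B))

  multinom-recurrence : ∀ B {n} p → length p ≡ suc n → All NonZero p → sum p ≤ B →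
    multinom p ≡ ℕ∑.∑[ v ∈ oneTo B ] (if does (v ∈? p) then multinom (delete v p) else 0)
  multinom-recurrence B {n} p len nz p≤B = begin
    multinom p                     ≡⟨ multinom≡arrangements B p nz p≤B ⟩
    arrangements (length p) B p    ≡⟨ cong (λ k → arrangements k B p) len ⟩
    arrangements (suc n) B p       ≡⟨ ℕ∑.∑-cong (oneTo B) (λ {v} _ → shorter v) ⟩
    ℕ∑.∑[ v ∈ oneTo B ] (if does (v ∈? p) then multinom (delete v p) else 0) ∎
    where
    shorter : ∀ v → (if does (v ∈? p) then arrangements n B (delete v p) else 0)
                  ≡ (if does (v ∈? p) then multinom (delete v p) else 0)
    shorter v with v ∈? p
    ... | no _    = refl
    ... | yes v∈p = begin
      arrangements n B (delete v p)
        ≡⟨ cong (λ k → arrangements k B (delete v p)) len' ⟩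
      arrangements (length (delete v p)) B (delete v p)
        ≡⟨ multinom≡arrangements B (delete v p) (All-delete nz) sum≤B ⟨
      multinom (delete v p) ∎
      where
      len' : n ≡ length (delete v p)
      len' = ℕP.suc-injective (trans (sym len) (length-delete v∈p))
      sum≤B : sum (delete v p) ≤ B
      sum≤B = ℕP.≤-trans (ℕP.m≤n+m _ v) (ℕP.≤-trans (ℕP.≤-reflexive (sym (sum-↭ (delete-↭ v∈p)))) p≤B)

open Multiplicities

module PartitionEnumerations where

  open import Data.Nat using (_+_)
  open import Data.List.Properties using (map-∘; map-id-local)
  open import Data.List.Membership.Propositional.Properties using (∈-map⁺; ∈-map⁻; ∈-filter⁺; ∈-filter⁻)
  open import Data.List.Relation.Unary.Linked.Properties using (Linked⇒AllPairs; AllPairs⇒Linked)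
  import Data.List.Relation.Unary.Unique.Propositional.Properties as Unique
  open import Relation.Binary.Properties.DecTotalOrder ℕP.≤-decTotalOrder using (≥-decTotalOrder)
  open import Data.List.Sort.InsertionSort.Base ≥-decTotalOrder using (insert)
  open import Data.List.Sort.InsertionSort.Properties ≥-decTotalOrder using (insert-↭; insert-↗)
  open ≡-Reasoning

  insert-head : ∀ {v x} xs → x ≤ v → insert v (x ∷ xs) ≡ v ∷ x ∷ xs
  insert-head {v} {x} xs x≤v rewrite dec-true (x ≤? v) x≤v = refl

  insert-skip : ∀ {v x} xs → ¬ x ≤ v → insert v (x ∷ xs) ≡ x ∷ insert v xs
  insert-skip {v} {x} xs x≰v rewrite dec-false (x ≤? v) x≰v = refl

  delete-insert : ∀ v p → delete v (insert v p) ≡ p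
  delete-insert v []       = delete-here v []
  delete-insert v (x ∷ xs) with x ≤? v
  ... | yes x≤v rewrite insert-head xs x≤v = delete-here v (x ∷ xs)
  ... | no x≰v  rewrite insert-skip xs x≰v =
    trans (delete-there {v} (insert v xs) (λ { refl → x≰v ℕP.≤-refl })) (cong (x ∷_) (delete-insert v xs))

  Sorted : List ℕ → Set
  Sorted = Linked _≥_

  Sorted⇒AllPairs : ∀ {p} → Sorted p → AllPairs _≥_ p
  Sorted⇒AllPairs = Linked⇒AllPairs (λ x≥y y≥z → ℕP.≤-trans y≥z x≥y)

  insert-delete : ∀ {v p} → Sorted p → v ∈ p → insert v (delete v p) ≡ p
  insert-delete {v} {x ∷ xs} sorted v∈ with v ≟ x | Sorted⇒AllPairs sorted
  ... | yes refl | x≥xs ∷ _ = head xs x≥xs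
    where
    head : ∀ ys → All (v ≥_) ys → insert v ys ≡ v ∷ ys
    head []       _           = refl
    head (y ∷ ys) (v≥y ∷ _)   = insert-head ys v≥y
  insert-delete {v} {x ∷ xs} sorted (here v≡x) | no v≢x | _ = ⊥-elim (v≢x v≡x)
  insert-delete {v} {x ∷ xs} sorted (there v∈) | no v≢x | x≥xs ∷ xs* = begin
    insert v (x ∷ delete v xs)     ≡⟨ insert-skip (delete v xs) x≰v ⟩
    x ∷ insert v (delete v xs)     ≡⟨ cong (x ∷_) (insert-delete (AllPairs⇒Linked xs*) v∈) ⟩
    x ∷ xs                         ∎
    where
    x≰v : ¬ x ≤ v
    x≰v x≤v = v≢x (ℕP.≤-antisym (All.lookup x≥xs v∈) x≤v)

  ∈-insert : ∀ v p → v ∈ insert v p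
  ∈-insert v p = Any-resp-↭ (↭-sym (insert-↭ v p)) (here refl)

  insert-⊢ : ∀ {v k p} → NonZero v → p ⊢ k → insert v p ⊢ (v + k)
  insert-⊢ {v} {k} {p} v≢0 (sum≡k , nz , sorted) =
    trans (sum-↭ (insert-↭ v p)) (cong (v +_) sum≡k) ,
    All-resp-↭ (↭-sym (insert-↭ v p)) (v≢0 ∷ nz) ,
    insert-↗ v sorted

  delete-⊢ : ∀ {v m p} → v ∈ p → p ⊢ m → delete v p ⊢ (m ∸ v)
  delete-⊢ {v} {m} {p} v∈ (sum≡m , nz , sorted) =
    sum-delete , All-delete nz , AllPairs⇒Linked (AllPairs-delete (Sorted⇒AllPairs sorted))
    where
    sum-delete : sum (delete v p) ≡ m ∸ v
    sum-delete = trans (sym (ℕP.m+n∸m≡n v _)) (cong (_∸ v) (trans (sym (sum-↭ (delete-↭ v∈))) sum≡m))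

  Enumerates : ℕ → List (List ℕ) → Set
  Enumerates m ps = Unique ps × (∀ p → p ∈ ps → p ⊢ m) × (∀ p → p ⊢ m → p ∈ ps)

  splitOff : ℕ → List (List ℕ) → List (List ℕ)
  splitOff v ps = map (delete v) (filter (v ∈?_) ps)

  Enumerates-splitOff : ∀ {m ps v} → 1 ≤ v → v ≤ m → Enumerates m ps → Enumerates (m ∸ v) (splitOff v ps)
  Enumerates-splitOff {m} {ps} {v} 1≤v v≤m (unique , sound , complete) = unique' , sound' , complete'
    where
    containing = filter (v ∈?_) ps
    reinsert : map (insert v) (splitOff v ps) ≡ containing
    reinsert = trans (sym (map-∘ containing)) (map-id-local (All.tabulate λ p∈ →
      let p∈ps , v∈p = ∈-filter⁻ (v ∈?_) p∈ in insert-delete (proj₂ (proj₂ (sound _ p∈ps))) v∈p))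
    unique' : Unique (splitOff v ps)
    unique' = Unique.map⁻ (subst Unique (sym reinsert) (Unique.filter⁺ (v ∈?_) unique))
    sound' : ∀ p → p ∈ splitOff v ps → p ⊢ (m ∸ v)
    sound' p p∈ with ∈-map⁻ (delete v) p∈
    ... | p₀ , p₀∈ , refl with ∈-filter⁻ (v ∈?_) p₀∈
    ...   | p₀∈ps , v∈p₀ = delete-⊢ v∈p₀ (sound p₀ p₀∈ps)
    complete' : ∀ p → p ⊢ (m ∸ v) → p ∈ splitOff v ps
    complete' p p⊢ = subst (_∈ splitOff v ps) (delete-insert v p)
      (∈-map⁺ (delete v) (∈-filter⁺ (v ∈?_) (complete _ inserted) (∈-insert v p)))
      where
      inserted : insert v p ⊢ m
      inserted = subst (insert v p ⊢_) (ℕP.m+[n∸m]≡n v≤m) (insert-⊢ (ℕ.>-nonZero 1≤v) p⊢)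

open PartitionEnumerations

module MatrixCounts where

  open import Data.Nat using (_+_; _*_)
  open import Data.Bool.Properties using (∧-commutativeMonoid; ∧-comm; ∧-zeroʳ)
  open import Algebra.Properties.CommutativeSemigroup (CommutativeMonoid.commutativeSemigroup ∧-commutativeMonoid)
    using () renaming (interchange to ∧-interchange)
  open import Data.Vec using (toList; transpose; replicate; _⊛_)
  open ≡-Reasoning

  𝟙 : Bool → ℕ
  𝟙 true  = 1
  𝟙 false = 0

  𝟙-∧ : ∀ a b → 𝟙 (a ∧ b) ≡ 𝟙 a * 𝟙 b
  𝟙-∧ true  b = sym (ℕP.+-identityʳ (𝟙 b))
  𝟙-∧ false b = refl

  length-filter-∑ : ∀ {A : Set} {P : A → Set} (P? : ∀ x → Dec (P x)) xs →
                  length (filter P? xs) ≡ ℕ∑.∑[ x ∈ xs ] 𝟙 (does (P? x))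
  length-filter-∑ P? []       = refl
  length-filter-∑ P? (x ∷ xs) with does (P? x)
  ... | true  = cong suc (length-filter-∑ P? xs)
  ... | false = length-filter-∑ P? xs

  -- fits r q: the 0-1 row r lies entrywise below q.  The other rows of the matrix must
  -- then have column sums q ⊖ r.
  fitsEntry : Bool → ℕ → Bool
  fitsEntry false _       = true
  fitsEntry true  zero    = false
  fitsEntry true  (suc _) = true

  fits : ∀ {c} → Vec Bool c → List ℕ → Bool
  fits []      []       = true
  fits []      (_ ∷ _)  = false
  fits (_ ∷ _) []       = false
  fits (b ∷ r) (x ∷ xs) = fitsEntry b x ∧ fits r xs

  infixl 6 _⊖_ _⊕_
  infix 4 _≟ₗ_

  _⊖_ : ∀ {c} → List ℕ → Vec Bool c → List ℕ
  xs       ⊖ []      = xs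
  []       ⊖ (_ ∷ _) = []
  (x ∷ xs) ⊖ (b ∷ r) = (x ∸ 𝟙 b) ∷ (xs ⊖ r)

  _⊕_ : ∀ {c} → Vec Bool c → List ℕ → List ℕ
  []      ⊕ xs       = xs
  (_ ∷ _) ⊕ []       = []
  (b ∷ r) ⊕ (x ∷ xs) = (𝟙 b + x) ∷ (r ⊕ xs)

  length-⊖ : ∀ {c} q (r : Vec Bool c) → length (q ⊖ r) ≡ length q
  length-⊖ q        []      = refl
  length-⊖ []       (_ ∷ _) = refl
  length-⊖ (x ∷ xs) (b ∷ r) = cong suc (length-⊖ xs r)

  colSums-∷ : ∀ {m c} (row : Vec Bool c) (M : Vec (Vec Bool c) m) → colSums (row ∷ M) ≡ row ⊕ colSums M
  colSums-∷ row M = columns row (transpose M)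
    where
    columns : ∀ {c n} (row : Vec Bool c) (T : Vec (Vec Bool n) c) →
              toList (V.map countTrue ((replicate c _∷_ ⊛ row) ⊛ T)) ≡ row ⊕ toList (V.map countTrue T)
    columns []          []      = refl
    columns (true ∷ r)  (t ∷ T) = cong (suc (countTrue t) ∷_) (columns r T)
    columns (false ∷ r) (t ∷ T) = cong (countTrue t ∷_) (columns r T)

  _≟ₗ_ : (xs ys : List ℕ) → Dec (xs ≡ ys)
  _≟ₗ_ = ≡-dec _≟_

  ⊕-≟ : ∀ {c} (r : Vec Bool c) (X : Vec ℕ c) q →
        does (r ⊕ toList X ≟ₗ q) ≡ fits r q ∧ does (toList X ≟ₗ q ⊖ r)
  ⊕-≟ []      []      []       = refl
  ⊕-≟ []      []      (_ ∷ _)  = refl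
  ⊕-≟ (b ∷ r) (y ∷ X) []       = refl
  ⊕-≟ (b ∷ r) (y ∷ X) (x ∷ q)  = trans (cong₂ _∧_ (entry b x) (⊕-≟ r X q))
                                         (∧-interchange (fitsEntry b x) _ (fits r q) _)
    where
    entry : ∀ b x → does (𝟙 b + y ≟ x) ≡ fitsEntry b x ∧ does (y ≟ x ∸ 𝟙 b)
    entry false x       = refl
    entry true  zero    = refl
    entry true  (suc x) = refl

  hasMargins : ∀ {m c} → Vec (Vec Bool c) m → List ℕ → List ℕ → Bool
  hasMargins M p q = does (rowSums M ≟ₗ p) ∧ does (colSums M ≟ₗ q)

  N-as-sum : ∀ p q {c} → length q ≡ c → N p q ≡ ℕ∑.∑[ M ∈ allMats (length p) c ] 𝟙 (hasMargins M p q)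
  N-as-sum p q refl = length-filter-∑ (λ M → rowSums M ≟ₗ p ×-dec colSums M ≟ₗ q) (allMats (length p) (length q))

  rowWeight : ∀ {c} → ℕ → Vec Bool c → List ℕ → ℕ
  rowWeight a r q = 𝟙 (does (countTrue r ≟ a) ∧ fits r q)

  hasMargins-∷ : ∀ {m c} a α q (r : Vec Bool c) (M : Vec (Vec Bool c) m) →
                 𝟙 (hasMargins (r ∷ M) (a ∷ α) q) ≡ rowWeight a r q * 𝟙 (hasMargins M α (q ⊖ r))
  hasMargins-∷ a α q r M = begin
    𝟙 ((A ∧ R) ∧ does (colSums (r ∷ M) ≟ₗ q))
      ≡⟨ cong (λ xs → 𝟙 ((A ∧ R) ∧ does (xs ≟ₗ q))) (colSums-∷ r M) ⟩
    𝟙 ((A ∧ R) ∧ does (r ⊕ colSums M ≟ₗ q))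
      ≡⟨ cong (λ b → 𝟙 ((A ∧ R) ∧ b)) (⊕-≟ r (V.map countTrue (transpose M)) q) ⟩
    𝟙 ((A ∧ R) ∧ (fits r q ∧ C))
      ≡⟨ cong 𝟙 (∧-interchange A R (fits r q) C) ⟩
    𝟙 ((A ∧ fits r q) ∧ (R ∧ C))
      ≡⟨ 𝟙-∧ (A ∧ fits r q) (R ∧ C) ⟩
    rowWeight a r q * 𝟙 (hasMargins M α (q ⊖ r)) ∎
    where
    A = does (countTrue r ≟ a)
    R = does (rowSums M ≟ₗ α)
    C = does (colSums M ≟ₗ q ⊖ r)

  N-∷ : ∀ a α q {c} → length q ≡ c → N (a ∷ α) q ≡ ℕ∑.∑[ r ∈ allVecs c ] rowWeight a r q * N α (q ⊖ r)
  N-∷ a α q {c} len = begin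
    N (a ∷ α) q
      ≡⟨ N-as-sum (a ∷ α) q len ⟩
    ℕ∑.∑ (concatMap (λ r → map (r ∷_) mats) (allVecs c)) (λ M → 𝟙 (hasMargins M (a ∷ α) q))
      ≡⟨ ℕ∑.∑-concatMap (allVecs c) _ _ ⟩
    ℕ∑.∑[ r ∈ allVecs c ] ℕ∑.∑ (map (r ∷_) mats) (λ M → 𝟙 (hasMargins M (a ∷ α) q))
      ≡⟨ ℕ∑.∑-cong (allVecs c) (λ {r} _ → ℕ∑.∑-map mats (r ∷_) _) ⟩
    ℕ∑.∑[ r ∈ allVecs c ] ℕ∑.∑[ M ∈ mats ] 𝟙 (hasMargins (r ∷ M) (a ∷ α) q)
      ≡⟨ ℕ∑.∑-cong (allVecs c) (λ {r} _ → ℕ∑.∑-cong mats (λ {M} _ → hasMargins-∷ a α q r M)) ⟩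
    ℕ∑.∑[ r ∈ allVecs c ] ℕ∑.∑[ M ∈ mats ] (rowWeight a r q * 𝟙 (hasMargins M α (q ⊖ r)))
      ≡⟨ ℕ∑.∑-cong (allVecs c) (λ {r} _ → sym (ℕ∑.∑-distribˡ (rowWeight a r q) mats _)) ⟩
    ℕ∑.∑[ r ∈ allVecs c ] (rowWeight a r q * (ℕ∑.∑[ M ∈ mats ] 𝟙 (hasMargins M α (q ⊖ r))))
      ≡⟨ ℕ∑.∑-cong (allVecs c) (λ {r} _ → cong (rowWeight a r q *_)
           (sym (N-as-sum α (q ⊖ r) (trans (length-⊖ q r) len)))) ⟩
    ℕ∑.∑[ r ∈ allVecs c ] (rowWeight a r q * N α (q ⊖ r)) ∎
    where
    mats = allMats (length α) c

  ⊖-comm : ∀ {c} q (r s : Vec Bool c) → q ⊖ r ⊖ s ≡ q ⊖ s ⊖ r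
  ⊖-comm q        []      []      = refl
  ⊖-comm []       (_ ∷ _) (_ ∷ _) = refl
  ⊖-comm (x ∷ xs) (b ∷ r) (b' ∷ s) = cong₂ _∷_ (entry b b') (⊖-comm xs r s)
    where
    entry : ∀ b b' → x ∸ 𝟙 b ∸ 𝟙 b' ≡ x ∸ 𝟙 b' ∸ 𝟙 b
    entry b b' = trans (ℕP.∸-+-assoc x (𝟙 b) (𝟙 b'))
                   (trans (cong (x ∸_) (ℕP.+-comm (𝟙 b) (𝟙 b'))) (sym (ℕP.∸-+-assoc x (𝟙 b') (𝟙 b))))

  fits-⊖-comm : ∀ {c} q (r s : Vec Bool c) → fits r q ∧ fits s (q ⊖ r) ≡ fits s q ∧ fits r (q ⊖ s)
  fits-⊖-comm q        []      []       = ∧-comm (fits [] q) (fits [] q)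
  fits-⊖-comm []       (_ ∷ _) (_ ∷ _)  = refl
  fits-⊖-comm (x ∷ xs) (b ∷ r) (b' ∷ s) = begin
    (fitsEntry b x ∧ fits r xs) ∧ (fitsEntry b' (x ∸ 𝟙 b) ∧ fits s (xs ⊖ r))
      ≡⟨ ∧-interchange (fitsEntry b x) _ _ _ ⟩
    (fitsEntry b x ∧ fitsEntry b' (x ∸ 𝟙 b)) ∧ (fits r xs ∧ fits s (xs ⊖ r))
      ≡⟨ cong₂ _∧_ (entry b b' x) (fits-⊖-comm xs r s) ⟩
    (fitsEntry b' x ∧ fitsEntry b (x ∸ 𝟙 b')) ∧ (fits s xs ∧ fits r (xs ⊖ s))
      ≡⟨ ∧-interchange (fitsEntry b' x) _ _ _ ⟩
    (fitsEntry b' x ∧ fits s xs) ∧ (fitsEntry b (x ∸ 𝟙 b') ∧ fits r (xs ⊖ s)) ∎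
    where
    entry : ∀ b b' x → fitsEntry b x ∧ fitsEntry b' (x ∸ 𝟙 b) ≡ fitsEntry b' x ∧ fitsEntry b (x ∸ 𝟙 b')
    entry false b'   x       = ∧-comm true (fitsEntry b' x)
    entry true  false x      = ∧-comm (fitsEntry true x) true
    entry true  true  zero    = refl
    entry true  true  (suc x) = refl

  rowWeight-comm : ∀ a b {c} (r s : Vec Bool c) q →
                   rowWeight a r q * rowWeight b s (q ⊖ r) ≡ rowWeight b s q * rowWeight a r (q ⊖ s)
  rowWeight-comm a b r s q = begin
    𝟙 (A ∧ fits r q) * 𝟙 (B ∧ fits s (q ⊖ r))        ≡⟨ 𝟙-∧ (A ∧ fits r q) _ ⟨
    𝟙 ((A ∧ fits r q) ∧ (B ∧ fits s (q ⊖ r)))        ≡⟨ cong 𝟙 (∧-interchange A _ B _) ⟩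
    𝟙 ((A ∧ B) ∧ (fits r q ∧ fits s (q ⊖ r)))        ≡⟨ cong₂ (λ x y → 𝟙 (x ∧ y)) (∧-comm A B) (fits-⊖-comm q r s) ⟩
    𝟙 ((B ∧ A) ∧ (fits s q ∧ fits r (q ⊖ s)))        ≡⟨ cong 𝟙 (∧-interchange B A _ _) ⟩
    𝟙 ((B ∧ fits s q) ∧ (A ∧ fits r (q ⊖ s)))        ≡⟨ 𝟙-∧ (B ∧ fits s q) _ ⟩
    𝟙 (B ∧ fits s q) * 𝟙 (A ∧ fits r (q ⊖ s))        ∎
    where
    A = does (countTrue r ≟ a)
    B = does (countTrue s ≟ b)

  twoRows : ℕ → ℕ → List ℕ → List ℕ → ℕ
  twoRows a b α q = ℕ∑.∑[ r ∈ allVecs (length q) ] ℕ∑.∑[ s ∈ allVecs (length q) ]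
                      (rowWeight a r q * (rowWeight b s (q ⊖ r) * N α (q ⊖ r ⊖ s)))

  N-∷-∷ : ∀ a b α q → N (a ∷ b ∷ α) q ≡ twoRows a b α q
  N-∷-∷ a b α q = trans (N-∷ a (b ∷ α) q refl) (ℕ∑.∑-cong rows λ {r} _ →
    trans (cong (rowWeight a r q *_) (N-∷ b α (q ⊖ r) (length-⊖ q r))) (ℕ∑.∑-distribˡ (rowWeight a r q) rows _))
    where rows = allVecs (length q)

  twoRows-comm : ∀ a b α q → twoRows a b α q ≡ twoRows b a α q
  twoRows-comm a b α q =
    trans (ℕ∑.∑-cong rows (λ {r} _ → ℕ∑.∑-cong rows (λ {s} _ → swapRows r s))) (ℕ∑.∑-comm rows rows _)
    where
    rows = allVecs (length q)
    swapRows : ∀ r s → rowWeight a r q * (rowWeight b s (q ⊖ r) * N α (q ⊖ r ⊖ s))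
                     ≡ rowWeight b s q * (rowWeight a r (q ⊖ s) * N α (q ⊖ s ⊖ r))
    swapRows r s = begin
      rowWeight a r q * (rowWeight b s (q ⊖ r) * N α (q ⊖ r ⊖ s))
        ≡⟨ ℕP.*-assoc (rowWeight a r q) _ _ ⟨
      rowWeight a r q * rowWeight b s (q ⊖ r) * N α (q ⊖ r ⊖ s)
        ≡⟨ cong₂ _*_ (rowWeight-comm a b r s q) (cong (N α) (⊖-comm q r s)) ⟩
      rowWeight b s q * rowWeight a r (q ⊖ s) * N α (q ⊖ s ⊖ r)
        ≡⟨ ℕP.*-assoc (rowWeight b s q) _ _ ⟩
      rowWeight b s q * (rowWeight a r (q ⊖ s) * N α (q ⊖ s ⊖ r)) ∎

  N-swap : ∀ a b α q → N (a ∷ b ∷ α) q ≡ N (b ∷ a ∷ α) q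
  N-swap a b α q = trans (N-∷-∷ a b α q) (trans (twoRows-comm a b α q) (sym (N-∷-∷ b a α q)))

  N-prep : ∀ a {α β} → (∀ q → N α q ≡ N β q) → ∀ q → N (a ∷ α) q ≡ N (a ∷ β) q
  N-prep a {α} {β} N≡ q = trans (N-∷ a α q refl)
    (trans (ℕ∑.∑-cong (allVecs (length q)) (λ {r} _ → cong (rowWeight a r q *_) (N≡ (q ⊖ r))))
             (sym (N-∷ a β q refl)))

  N-↭ : ∀ {p p'} → p ↭ p' → ∀ q → N p q ≡ N p' q
  N-↭ ↭.refl         q = refl
  N-↭ (↭.prep x σ)   q = N-prep x (N-↭ σ) q
  N-↭ (↭.swap x y σ) q = trans (N-swap x y _ q) (N-prep y (N-prep x (N-↭ σ)) q)
  N-↭ (↭.trans σ₁ σ₂) q = trans (N-↭ σ₁ q) (N-↭ σ₂ q)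

  colSums-[] : ∀ q → sum q ≡ 0 → colSums {0} {length q} [] ≡ q
  colSums-[] []      _     = refl
  colSums-[] (x ∷ q) sum≡0 with ℕP.m+n≡0⇒m≡0 x sum≡0
  ... | refl = cong (0 ∷_) (colSums-[] q sum≡0)

  N-[] : ∀ q → sum q ≡ 0 → N [] q ≡ 1
  N-[] q sum≡0 rewrite dec-true (colSums {0} {length q} [] ≟ₗ q) (colSums-[] q sum≡0) = refl

  rowWeight-other : ∀ {v c} (r : Vec Bool c) q → countTrue r ≢ v → rowWeight v r q ≡ 0
  rowWeight-other {v} r q ct≢v rewrite dec-false (countTrue r ≟ v) ct≢v = refl

  rowWeight-unfit : ∀ {v c} (r : Vec Bool c) q → fits r q ≡ false → rowWeight v r q ≡ 0
  rowWeight-unfit {v} r q unfit rewrite unfit = cong 𝟙 (∧-zeroʳ (does (countTrue r ≟ v)))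

  rowWeight-self : ∀ {c} (r : Vec Bool c) q → rowWeight (countTrue r) r q ≡ 𝟙 (fits r q)
  rowWeight-self r q rewrite dec-true (countTrue r ≟ countTrue r) refl = refl

  countTrue-≤-sum : ∀ {c} (r : Vec Bool c) q → fits r q ≡ true → countTrue r ≤ sum q
  countTrue-≤-sum []          []           _   = z≤n
  countTrue-≤-sum (false ∷ r) (x ∷ q)      fit = ℕP.≤-trans (countTrue-≤-sum r q fit) (ℕP.m≤n+m (sum q) x)
  countTrue-≤-sum (true ∷ r)  (suc x ∷ q)  fit = s≤s (countTrue-≤-sum (false ∷ r) (x ∷ q) fit)

  sum-⊖ : ∀ {c} (r : Vec Bool c) q → fits r q ≡ true → sum (q ⊖ r) ≡ sum q ∸ countTrue r
  sum-⊖ []          []          _   = refl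
  sum-⊖ (false ∷ r) (x ∷ q)     fit =
    trans (cong (x +_) (sum-⊖ r q fit)) (sym (ℕP.+-∸-assoc x (countTrue-≤-sum r q fit)))
  sum-⊖ (true ∷ r)  (suc x ∷ q) fit =
    trans (cong (x +_) (sum-⊖ r q fit)) (sym (ℕP.+-∸-assoc x (countTrue-≤-sum r q fit)))

  rowWeight-cases : ∀ v {c} (r : Vec Bool c) q → rowWeight v r q ≡ 0 ⊎ (countTrue r ≡ v × fits r q ≡ true)
  -- Matching on fits r q with `with` would also rewrite the copy hidden in rowWeight v r q.
  rowWeight-cases v r q with countTrue r ≟ v
  ... | no ct≢v  = inj₁ (rowWeight-other r q ct≢v)
  ... | yes ct≡v = byFit (fits r q) refl
    where
    byFit : ∀ b → fits r q ≡ b → rowWeight v r q ≡ 0 ⊎ (countTrue r ≡ v × fits r q ≡ true)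
    byFit false unfit = inj₁ (rowWeight-unfit r q unfit)
    byFit true  fit   = inj₂ (ct≡v , fit)

open MatrixCounts

module SignedSums where

  open import Data.Integer using (+_; _+_; _*_; -_)
  open import Data.Integer.Solver using (module +-*-Solver)
  open import Data.Nat.DivMod using (0/n≡0)
  import Data.Integer.Properties as ℤP
  open import Algebra.Properties.CommutativeSemigroup ℤP.*-commutativeSemigroup using (x∙yz≈y∙xz)
  open ListSum ℤP.+-*-commutativeSemiring
  open ≡-Reasoning

  sgn-suc : ∀ n → sgn (suc n) ≡ - sgn n
  sgn-suc zero          = refl
  sgn-suc (suc zero)    = refl
  sgn-suc (suc (suc n)) = sgn-suc n

  sgn-+ : ∀ a b → sgn (a ℕ.+ b) ≡ sgn a * sgn b
  sgn-+ zero    b = sym (ℤP.*-identityˡ (sgn b))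
  sgn-+ (suc a) b = begin
    sgn (suc (a ℕ.+ b))     ≡⟨ sgn-suc (a ℕ.+ b) ⟩
    - sgn (a ℕ.+ b)         ≡⟨ cong -_ (sgn-+ a b) ⟩
    - (sgn a * sgn b)       ≡⟨ ℤP.neg-distribˡ-* (sgn a) (sgn b) ⟩
    - sgn a * sgn b         ≡⟨ cong (_* sgn b) (sgn-suc a) ⟨
    sgn (suc a) * sgn b     ∎

  sgn-*-sgn : ∀ k → sgn k * sgn k ≡ + 1
  sgn-*-sgn zero          = refl
  sgn-*-sgn (suc zero)    = refl
  sgn-*-sgn (suc (suc k)) = sgn-*-sgn k

  sgn-∸ : ∀ m k → k ≤ m → sgn (m ∸ k) ≡ sgn m * sgn k
  sgn-∸ m k k≤m = begin
    sgn (m ∸ k)                      ≡⟨ ℤP.*-identityʳ _ ⟨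
    sgn (m ∸ k) * + 1                ≡⟨ cong (sgn (m ∸ k) *_) (sgn-*-sgn k) ⟨
    sgn (m ∸ k) * (sgn k * sgn k)    ≡⟨ ℤP.*-assoc (sgn (m ∸ k)) _ _ ⟨
    sgn (m ∸ k) * sgn k * sgn k      ≡⟨ cong (_* sgn k) (sgn-+ (m ∸ k) k) ⟨
    sgn (m ∸ k ℕ.+ k) * sgn k        ≡⟨ cong (λ n → sgn n * sgn k) (ℕP.m∸n+n≡m k≤m) ⟩
    sgn m * sgn k                    ∎

  ∑-neg : ∀ {A : Set} (xs : List A) (f : A → ℤ) → ∑[ x ∈ xs ] - f x ≡ - ∑ xs f
  ∑-neg xs f = begin
    ∑[ x ∈ xs ] - f x            ≡⟨ ∑-cong xs (λ _ → ℤP.-1*i≡-i _) ⟨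
    ∑[ x ∈ xs ] (- + 1 * f x)    ≡⟨ ∑-distribˡ (- + 1) xs f ⟨
    - + 1 * ∑ xs f               ≡⟨ ℤP.-1*i≡-i _ ⟩
    - ∑ xs f                     ∎

  +-∑ : ∀ {A : Set} (xs : List A) (f : A → ℕ) → + ℕ∑.∑ xs f ≡ ∑[ x ∈ xs ] + f x
  +-∑ []       f = refl
  +-∑ (x ∷ xs) f = trans (ℤP.pos-+ (f x) _) (cong (_+_ (+ f x)) (+-∑ xs f))

  signedMultinom : List ℕ → ℤ
  signedMultinom p = sgn (numParts p) * + multinom p

  weightedSum : List (List ℕ) → (List ℕ → ℤ) → ℤ
  weightedSum ps f = ∑[ p ∈ ps ] (signedMultinom p * f p)

  length-⊢-suc : ∀ {m} p → p ⊢ suc m → length p ≡ suc (ℕ.pred (length p))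
  length-⊢-suc []      (() , _)
  length-⊢-suc (_ ∷ _) _ = refl

  signedMultinom-recurrence : ∀ {m} p → p ⊢ suc m →
    signedMultinom p ≡ - (∑[ v ∈ oneTo (suc m) ] (if does (v ∈? p) then signedMultinom (delete v p) else + 0))
  signedMultinom-recurrence {m} p p⊢@(sum≡ , nz , _) = begin
    sgn (length p) * + multinom p
      ≡⟨ cong (λ n → sgn (length p) * + n)
           (multinom-recurrence (suc m) p (length-⊢-suc p p⊢) nz (ℕP.≤-reflexive sum≡)) ⟩
    sgn (length p) * + ℕ∑.∑ (oneTo (suc m)) term
      ≡⟨ cong (sgn (length p) *_) (+-∑ (oneTo (suc m)) term) ⟩
    sgn (length p) * (∑[ v ∈ oneTo (suc m) ] + term v)
      ≡⟨ ∑-distribˡ (sgn (length p)) (oneTo (suc m)) (+_ ∘ term) ⟩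
    ∑[ v ∈ oneTo (suc m) ] (sgn (length p) * + term v)
      ≡⟨ ∑-cong (oneTo (suc m)) (λ {v} _ → perPart v) ⟩
    ∑[ v ∈ oneTo (suc m) ] - (if does (v ∈? p) then signedMultinom (delete v p) else + 0)
      ≡⟨ ∑-neg (oneTo (suc m)) (λ v → if does (v ∈? p) then signedMultinom (delete v p) else + 0) ⟩
    - (∑[ v ∈ oneTo (suc m) ] (if does (v ∈? p) then signedMultinom (delete v p) else + 0)) ∎
    where
    term : ℕ → ℕ
    term v = if does (v ∈? p) then multinom (delete v p) else 0
    perPart : ∀ v → sgn (length p) * + term v ≡ - (if does (v ∈? p) then signedMultinom (delete v p) else + 0)
    perPart v with v ∈? p
    ... | no _    = ℤP.*-zeroʳ (sgn (length p))
    ... | yes v∈p = begin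
      sgn (length p) * + multinom p'           ≡⟨ cong (λ n → sgn n * + multinom p') (length-delete v∈p) ⟩
      sgn (suc (length p')) * + multinom p'    ≡⟨ cong (_* + multinom p') (sgn-suc (length p')) ⟩
      - sgn (length p') * + multinom p'        ≡⟨ ℤP.neg-distribˡ-* (sgn (length p')) (+ multinom p') ⟨
      - signedMultinom p'                      ∎
      where p' = delete v p

  weightedSum-splitOff : ∀ {m ps} → Enumerates (suc m) ps →
    (f : List ℕ → ℤ) → (∀ {p p'} → p ↭ p' → f p ≡ f p') →
    weightedSum ps f ≡ - (∑[ v ∈ oneTo (suc m) ] weightedSum (splitOff v ps) (λ p' → f (v ∷ p')))
  weightedSum-splitOff {m} {ps} (_ , sound , _) f f-↭ = begin
    ∑[ p ∈ ps ] (signedMultinom p * f p)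
      ≡⟨ ∑-cong ps (λ {p} p∈ → perPartition p (sound p p∈)) ⟩
    ∑[ p ∈ ps ] - (∑[ v ∈ parts ] g v p)
      ≡⟨ ∑-neg ps (λ p → ∑[ v ∈ parts ] g v p) ⟩
    - (∑[ p ∈ ps ] ∑[ v ∈ parts ] g v p)
      ≡⟨ cong -_ (∑-comm ps parts (λ p v → g v p)) ⟩
    - (∑[ v ∈ parts ] ∑[ p ∈ ps ] g v p)
      ≡⟨ cong -_ (∑-cong parts (λ {v} _ → sym (∑-filter (v ∈?_) ps (h v ∘ delete v)))) ⟩
    - (∑[ v ∈ parts ] ∑[ p ∈ filter (v ∈?_) ps ] h v (delete v p))
      ≡⟨ cong -_ (∑-cong parts (λ {v} _ → sym (∑-map (filter (v ∈?_) ps) (delete v) (h v)))) ⟩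
    - (∑[ v ∈ parts ] weightedSum (splitOff v ps) (λ p' → f (v ∷ p'))) ∎
    where
    parts = oneTo (suc m)
    h : ℕ → List ℕ → ℤ
    h v p' = signedMultinom p' * f (v ∷ p')
    g : ℕ → List ℕ → ℤ
    g v p = if does (v ∈? p) then h v (delete v p) else + 0
    perPartition : ∀ p → p ⊢ suc m → signedMultinom p * f p ≡ - (∑[ v ∈ parts ] g v p)
    perPartition p p⊢ = begin
      signedMultinom p * f p
        ≡⟨ cong (_* f p) (signedMultinom-recurrence p p⊢) ⟩
      - (∑ parts d) * f p
        ≡⟨ ℤP.neg-distribˡ-* (∑ parts d) (f p) ⟨
      - (∑ parts d * f p)
        ≡⟨ cong -_ (∑-distribʳ (f p) parts d) ⟩
      - (∑[ v ∈ parts ] (d v * f p))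
        ≡⟨ cong -_ (∑-cong parts (λ {v} _ → moveToFront v)) ⟩
      - (∑[ v ∈ parts ] g v p) ∎
      where
      d : ℕ → ℤ
      d v = if does (v ∈? p) then signedMultinom (delete v p) else + 0
      moveToFront : ∀ v → d v * f p ≡ g v p
      moveToFront v with v ∈? p
      ... | no _    = refl
      ... | yes v∈p = cong (signedMultinom (delete v p) *_) (f-↭ (delete-↭ v∈p))

  δ₀ : ℕ → ℤ
  δ₀ zero    = + 1
  δ₀ (suc _) = + 0

  signIfPositive : ℕ → ℤ
  signIfPositive zero    = + 0
  signIfPositive (suc k) = sgn (suc k)

  signIfPositive-step : ∀ k → signIfPositive k + signIfPositive (suc k) ≡ - δ₀ k
  signIfPositive-step zero    = refl
  signIfPositive-step (suc k) = trans (cong (_+ sgn k) (sgn-suc k)) (ℤP.+-inverseˡ (sgn k))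

  ∑-fits-δ₀ : ∀ q → ∑[ r ∈ allVecs (length q) ] (+ 𝟙 (fits r q) * δ₀ (countTrue r)) ≡ + 1
  ∑-fits-δ₀ []      = refl
  ∑-fits-δ₀ (x ∷ q) = begin
    ∑ (concatMap (λ v → (false ∷ v) ∷ (true ∷ v) ∷ []) (allVecs (length q))) term
      ≡⟨ ∑-concatMap (allVecs (length q)) _ term ⟩
    ∑[ v ∈ allVecs (length q) ] (term (false ∷ v) + (term (true ∷ v) + + 0))
      ≡⟨ ∑-cong (allVecs (length q)) (λ {v} _ → onlyFalse v) ⟩
    ∑[ v ∈ allVecs (length q) ] (+ 𝟙 (fits v q) * δ₀ (countTrue v))
      ≡⟨ ∑-fits-δ₀ q ⟩
    + 1 ∎
    where
    term : Vec Bool (suc (length q)) → ℤ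
    term r = + 𝟙 (fits r (x ∷ q)) * δ₀ (countTrue r)
    onlyFalse : ∀ v → term (false ∷ v) + (term (true ∷ v) + + 0) ≡ term (false ∷ v)
    onlyFalse v = trans (cong (_+_ (term (false ∷ v))) (trans (ℤP.+-identityʳ _) (ℤP.*-zeroʳ (+ 𝟙 (fits (true ∷ v) (x ∷ q))))))
                        (ℤP.+-identityʳ _)

  ∑-fits-signIfPositive : ∀ q → sum q ≢ 0 →
    ∑[ r ∈ allVecs (length q) ] (+ 𝟙 (fits r q) * signIfPositive (countTrue r)) ≡ - + 1
  ∑-fits-signIfPositive []      sum≢0 = ⊥-elim (sum≢0 refl)
  ∑-fits-signIfPositive (x ∷ q) sum≢0 = trans (∑-concatMap (allVecs (length q)) _ term) (firstColumn x sum≢0)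
    where
    term : ∀ {y} → Vec Bool (suc (length q)) → ℤ
    term {y} r = + 𝟙 (fits r (y ∷ q)) * signIfPositive (countTrue r)
    firstColumn : ∀ y → sum (y ∷ q) ≢ 0 →
      ∑[ v ∈ allVecs (length q) ] (term {y} (false ∷ v) + (term {y} (true ∷ v) + + 0)) ≡ - + 1
    firstColumn zero    sum≢0 =
      trans (∑-cong (allVecs (length q)) (λ _ → ℤP.+-identityʳ _)) (∑-fits-signIfPositive q sum≢0)
    firstColumn (suc y) _     = begin
      ∑[ v ∈ allVecs (length q) ] (a v * signIfPositive (countTrue v) + (a v * signIfPositive (suc (countTrue v)) + + 0))
        ≡⟨ ∑-cong (allVecs (length q)) (λ {v} _ → cancel v) ⟩
      ∑[ v ∈ allVecs (length q) ] - (a v * δ₀ (countTrue v))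
        ≡⟨ ∑-neg (allVecs (length q)) _ ⟩
      - (∑[ v ∈ allVecs (length q) ] (a v * δ₀ (countTrue v)))
        ≡⟨ cong -_ (∑-fits-δ₀ q) ⟩
      - + 1 ∎
      where
      a : Vec Bool (length q) → ℤ
      a v = + 𝟙 (fits v q)
      cancel : ∀ v → a v * signIfPositive (countTrue v) + (a v * signIfPositive (suc (countTrue v)) + + 0)
                   ≡ - (a v * δ₀ (countTrue v))
      cancel v = begin
        a v * s k + (a v * s (suc k) + + 0)  ≡⟨ cong (_+_ (a v * s k)) (ℤP.+-identityʳ _) ⟩
        a v * s k + a v * s (suc k)          ≡⟨ ℤP.*-distribˡ-+ (a v) (s k) (s (suc k)) ⟨
        a v * (s k + s (suc k))              ≡⟨ cong (a v *_) (signIfPositive-step k) ⟩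
        a v * - δ₀ k                         ≡⟨ ℤP.neg-distribʳ-* (a v) (δ₀ k) ⟨
        - (a v * δ₀ k)                       ∎
        where
        k = countTrue v
        s = signIfPositive

  ∑-rowWeight : ∀ m {c} (r : Vec Bool c) q {b k} → sum q ≡ m → fits r q ≡ b → countTrue r ≡ k →
    ∑[ v ∈ oneTo m ] (+ rowWeight v r q * sgn (m ∸ v)) ≡ sgn m * (+ 𝟙 b * signIfPositive k)
  ∑-rowWeight m r q {false} _ unfit _ = begin
    ∑[ v ∈ oneTo m ] (+ rowWeight v r q * sgn (m ∸ v))
      ≡⟨ ∑-cong (oneTo m) (λ _ → cong (λ w → + w * _) (rowWeight-unfit r q unfit)) ⟩
    ∑[ v ∈ oneTo m ] + 0                                   ≡⟨ ∑-zero (oneTo m) ⟩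
    + 0                                                    ≡⟨ ℤP.*-zeroʳ (sgn m) ⟨
    sgn m * + 0                                            ∎
  ∑-rowWeight m r q {true} {zero} _ _ ct = begin
    ∑[ v ∈ oneTo m ] (+ rowWeight v r q * sgn (m ∸ v))
      ≡⟨ ∑-cong (oneTo m) (λ v∈ → cong (λ w → + w * _) (rowWeight-other r q (positive v∈))) ⟩
    ∑[ v ∈ oneTo m ] + 0                                   ≡⟨ ∑-zero (oneTo m) ⟩
    + 0                                                    ≡⟨ ℤP.*-zeroʳ (sgn m) ⟨
    sgn m * + 0                                            ∎
    where
    positive : ∀ {v} → v ∈ oneTo m → countTrue r ≢ v
    positive v∈ ct≡v with ∈-oneTo⁻ v∈
    ... | 1≤v , _ = ℕP.<-irrefl (trans (sym ct) ct≡v) 1≤v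
  ∑-rowWeight m r q {true} {suc k} sum≡m fit ct = begin
    ∑[ v ∈ oneTo m ] (+ rowWeight v r q * sgn (m ∸ v))
      ≡⟨ ∑-oneTo-single m (λ v → + rowWeight v r q * sgn (m ∸ v)) other (s≤s z≤n) k<m ⟩
    + rowWeight (suc k) r q * sgn (m ∸ suc k)
      ≡⟨ cong (λ w → + w * sgn (m ∸ suc k)) self ⟩
    + 1 * sgn (m ∸ suc k)
      ≡⟨ ℤP.*-identityˡ _ ⟩
    sgn (m ∸ suc k)
      ≡⟨ sgn-∸ m (suc k) k<m ⟩
    sgn m * sgn (suc k)
      ≡⟨ cong (sgn m *_) (ℤP.*-identityˡ _) ⟨
    sgn m * (+ 1 * sgn (suc k)) ∎
    where
    other : ∀ {v} → v ≢ suc k → + rowWeight v r q * sgn (m ∸ v) ≡ + 0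
    other v≢ = cong (λ w → + w * _) (rowWeight-other r q (λ ct≡v → v≢ (trans (sym ct≡v) ct)))
    self : rowWeight (suc k) r q ≡ 1
    self = trans (cong (λ c → rowWeight c r q) (sym ct)) (trans (rowWeight-self r q) (cong 𝟙 fit))
    k<m : suc k ≤ m
    k<m = subst₂ _≤_ ct sum≡m (countTrue-≤-sum r q fit)

  ∑-rowWeight-sgn : ∀ m q → sum q ≡ suc m →
    ∑[ v ∈ oneTo (suc m) ] ∑[ r ∈ allVecs (length q) ] (+ rowWeight v r q * sgn (suc m ∸ v)) ≡ - sgn (suc m)
  ∑-rowWeight-sgn m q sum≡ = begin
    ∑[ v ∈ oneTo (suc m) ] ∑[ r ∈ allVecs (length q) ] (+ rowWeight v r q * sgn (suc m ∸ v))
      ≡⟨ ∑-comm (oneTo (suc m)) (allVecs (length q)) _ ⟩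
    ∑[ r ∈ allVecs (length q) ] ∑[ v ∈ oneTo (suc m) ] (+ rowWeight v r q * sgn (suc m ∸ v))
      ≡⟨ ∑-cong (allVecs (length q)) (λ {r} _ → ∑-rowWeight (suc m) r q sum≡ refl refl) ⟩
    ∑[ r ∈ allVecs (length q) ] (sgn (suc m) * (+ 𝟙 (fits r q) * signIfPositive (countTrue r)))
      ≡⟨ ∑-distribˡ (sgn (suc m)) (allVecs (length q)) _ ⟨
    sgn (suc m) * (∑[ r ∈ allVecs (length q) ] (+ 𝟙 (fits r q) * signIfPositive (countTrue r)))
      ≡⟨ cong (sgn (suc m) *_) (∑-fits-signIfPositive q (λ sum≡0 → ℕP.1+n≢0 (trans (sym sum≡) sum≡0))) ⟩
    sgn (suc m) * - + 1
      ≡⟨ ℤP.*-comm (sgn (suc m)) (- + 1) ⟩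
    - + 1 * sgn (suc m)
      ≡⟨ ℤP.-1*i≡-i (sgn (suc m)) ⟩
    - sgn (suc m) ∎

  ⊢0⇒[] : ∀ {p} → p ⊢ 0 → p ≡ []
  ⊢0⇒[] {[]}     _                  = refl
  ⊢0⇒[] {x ∷ xs} (sum≡0 , x≢0 ∷ _ , _) = ⊥-elim (ℕ.≢-nonZero⁻¹ x {{x≢0}} (ℕP.m+n≡0⇒m≡0 x sum≡0))

  Enumerates-zero : ∀ {ps} → Enumerates 0 ps → ps ≡ [] ∷ []
  Enumerates-zero {[]}         (_ , _ , complete) with complete [] (refl , [] , [])
  ... | ()
  Enumerates-zero {p ∷ []}     (_ , sound , _) = cong (_∷ []) (⊢0⇒[] (sound p (here refl)))
  Enumerates-zero {p ∷ p' ∷ _} ((p≢p' ∷ _) ∷ _ , sound , _) =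
    ⊥-elim (p≢p' (trans (⊢0⇒[] (sound p (here refl))) (sym (⊢0⇒[] (sound p' (there (here refl)))))))

  +N-∷ : ∀ a α q → + N (a ∷ α) q ≡ ∑[ r ∈ allVecs (length q) ] (+ rowWeight a r q * + N α (q ⊖ r))
  +N-∷ a α q = trans (cong +_ (N-∷ a α q refl))
    (trans (+-∑ (allVecs (length q)) _)
           (∑-cong (allVecs (length q)) (λ {r} _ → ℤP.pos-* (rowWeight a r q) (N α (q ⊖ r)))))

  weightedSum-N≡sgn : ∀ m → Acc _<_ m → ∀ {ps} → Enumerates m ps → ∀ q → sum q ≡ m →
                      weightedSum ps (λ p → + N p q) ≡ sgn m
  weightedSum-N≡sgn zero _ enum q sum≡0 rewrite Enumerates-zero enum | N-[] q sum≡0 = refl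
  weightedSum-N≡sgn (suc m) (acc smaller) {ps} enum q sum≡ = begin
    weightedSum ps (λ p → + N p q)
      ≡⟨ weightedSum-splitOff enum (λ p → + N p q) (λ σ → cong +_ (N-↭ σ q)) ⟩
    - (∑[ v ∈ oneTo (suc m) ] weightedSum (splitOff v ps) (λ p' → + N (v ∷ p') q))
      ≡⟨ cong -_ (∑-cong (oneTo (suc m)) firstRow) ⟩
    - (∑[ v ∈ oneTo (suc m) ] ∑[ r ∈ rows ] (+ rowWeight v r q * sgn (suc m ∸ v)))
      ≡⟨ cong -_ (∑-rowWeight-sgn m q sum≡) ⟩
    - - sgn (suc m)
      ≡⟨ ℤP.neg-involutive (sgn (suc m)) ⟩
    sgn (suc m) ∎
    where
    rows = allVecs (length q)
    firstRow : ∀ {v} → v ∈ oneTo (suc m) →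
      weightedSum (splitOff v ps) (λ p' → + N (v ∷ p') q) ≡ ∑[ r ∈ rows ] (+ rowWeight v r q * sgn (suc m ∸ v))
    firstRow {v} v∈ = begin
      ∑[ p' ∈ ps' ] (signedMultinom p' * + N (v ∷ p') q)
        ≡⟨ ∑-cong ps' (λ {p'} _ → cong (signedMultinom p' *_) (+N-∷ v p' q)) ⟩
      ∑[ p' ∈ ps' ] (signedMultinom p' * (∑[ r ∈ rows ] (w r * + N p' (q ⊖ r))))
        ≡⟨ ∑-cong ps' (λ {p'} _ → ∑-distribˡ (signedMultinom p') rows _) ⟩
      ∑[ p' ∈ ps' ] ∑[ r ∈ rows ] (signedMultinom p' * (w r * + N p' (q ⊖ r)))
        ≡⟨ ∑-cong ps' (λ {p'} _ → ∑-cong rows (λ {r} _ → x∙yz≈y∙xz (signedMultinom p') (w r) _)) ⟩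
      ∑[ p' ∈ ps' ] ∑[ r ∈ rows ] (w r * (signedMultinom p' * + N p' (q ⊖ r)))
        ≡⟨ ∑-comm ps' rows _ ⟩
      ∑[ r ∈ rows ] ∑[ p' ∈ ps' ] (w r * (signedMultinom p' * + N p' (q ⊖ r)))
        ≡⟨ ∑-cong rows (λ {r} _ → ∑-distribˡ (w r) ps' _) ⟨
      ∑[ r ∈ rows ] (w r * weightedSum ps' (λ p' → + N p' (q ⊖ r)))
        ≡⟨ ∑-cong rows (λ {r} _ → inductionStep r) ⟩
      ∑[ r ∈ rows ] (w r * sgn (suc m ∸ v)) ∎
      where
      ps' = splitOff v ps
      w : Vec Bool (length q) → ℤ
      w r = + rowWeight v r q
      1≤v = proj₁ (∈-oneTo⁻ v∈)
      v≤1+m = proj₂ (∈-oneTo⁻ v∈)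
      inductionStep : ∀ r → w r * weightedSum ps' (λ p' → + N p' (q ⊖ r)) ≡ w r * sgn (suc m ∸ v)
      inductionStep r with rowWeight-cases v r q
      ... | inj₁ w≡0 = trans (cong (λ n → + n * weightedSum ps' (λ p' → + N p' (q ⊖ r))) w≡0)
                             (cong (λ n → + n * sgn (suc m ∸ v)) (sym w≡0))
      ... | inj₂ (refl , fit) = cong (w r *_)
        (weightedSum-N≡sgn (suc m ∸ v) (smaller (ℕP.∸-monoʳ-< 1≤v v≤1+m)) (Enumerates-splitOff 1≤v v≤1+m enum)
                       (q ⊖ r) (trans (sum-⊖ r q fit) (cong (_∸ countTrue r) sum≡)))

  oneMinusX : ℕ → ℤ
  oneMinusX zero          = + 1
  oneMinusX (suc zero)    = - + 1
  oneMinusX (suc (suc _)) = + 0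

  ∑-oneMinusX-≥2 : ∀ j → ∑[ v ∈ oneTo j ] oneMinusX (suc (suc j) ∸ v) ≡ + 0
  ∑-oneMinusX-≥2 j = trans (∑-cong (oneTo j) (λ v∈ → atLeastTwo (proj₂ (∈-oneTo⁻ v∈)))) (∑-zero (oneTo j))
    where
    atLeastTwo : ∀ {v} → v ≤ j → oneMinusX (suc (suc j) ∸ v) ≡ + 0
    atLeastTwo v≤j rewrite ℕP.+-∸-assoc 2 v≤j = refl

  oneMinusX-recurrence : ∀ m → - (∑[ v ∈ oneTo (suc m) ] oneMinusX (suc m ∸ v)) ≡ oneMinusX (suc m)
  oneMinusX-recurrence zero    = refl
  oneMinusX-recurrence (suc j) rewrite ℕP.n∸n≡0 j | ℕP.m+n∸n≡m 1 j | ∑-oneMinusX-≥2 j = refl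

  ∑-signedMultinom : ∀ m → Acc _<_ m → ∀ {ps} → Enumerates m ps → ∑[ p ∈ ps ] signedMultinom p ≡ oneMinusX m
  ∑-signedMultinom zero _ enum rewrite Enumerates-zero enum = refl
  ∑-signedMultinom (suc m) (acc smaller) {ps} enum = begin
    ∑[ p ∈ ps ] signedMultinom p
      ≡⟨ ∑-cong ps (λ _ → ℤP.*-identityʳ _) ⟨
    weightedSum ps (λ _ → + 1)
      ≡⟨ weightedSum-splitOff enum (λ _ → + 1) (λ _ → refl) ⟩
    - (∑[ v ∈ oneTo (suc m) ] weightedSum (splitOff v ps) (λ _ → + 1))
      ≡⟨ cong -_ (∑-cong (oneTo (suc m)) shorter) ⟩
    - (∑[ v ∈ oneTo (suc m) ] oneMinusX (suc m ∸ v))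
      ≡⟨ oneMinusX-recurrence m ⟩
    oneMinusX (suc m) ∎
    where
    shorter : ∀ {v} → v ∈ oneTo (suc m) → weightedSum (splitOff v ps) (λ _ → + 1) ≡ oneMinusX (suc m ∸ v)
    shorter {v} v∈ with ∈-oneTo⁻ v∈
    ... | 1≤v , v≤1+m = trans (∑-cong (splitOff v ps) (λ _ → ℤP.*-identityʳ _))
      (∑-signedMultinom (suc m ∸ v) (smaller (ℕP.∸-monoʳ-< 1≤v v≤1+m)) (Enumerates-splitOff 1≤v v≤1+m enum))

  ∑∑-signedMultinom-N : ∀ {m ps} → Enumerates m ps →
    ∑[ p ∈ ps ] ∑[ q ∈ ps ] (signedMultinom q * (signedMultinom p * + N p q)) ≡ sgn m * oneMinusX m
  ∑∑-signedMultinom-N {m} {ps} enum@(_ , sound , _) = begin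
    ∑[ p ∈ ps ] ∑[ q ∈ ps ] (signedMultinom q * (signedMultinom p * + N p q))
      ≡⟨ ∑-comm ps ps _ ⟩
    ∑[ q ∈ ps ] ∑[ p ∈ ps ] (signedMultinom q * (signedMultinom p * + N p q))
      ≡⟨ ∑-cong ps (λ {q} _ → ∑-distribˡ (signedMultinom q) ps _) ⟨
    ∑[ q ∈ ps ] (signedMultinom q * weightedSum ps (λ p → + N p q))
      ≡⟨ ∑-cong ps (λ {q} q∈ → cong (signedMultinom q *_)
           (weightedSum-N≡sgn m (<-wellFounded m) enum q (proj₁ (sound q q∈)))) ⟩
    ∑[ q ∈ ps ] (signedMultinom q * sgn m)
      ≡⟨ ∑-distribʳ (sgn m) ps signedMultinom ⟨
    (∑[ q ∈ ps ] signedMultinom q) * sgn m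
      ≡⟨ cong (_* sgn m) (∑-signedMultinom m (<-wellFounded m) enum) ⟩
    oneMinusX m * sgn m
      ≡⟨ ℤP.*-comm (oneMinusX m) (sgn m) ⟩
    sgn m * oneMinusX m ∎

  sgn-*-oneMinusX : ∀ m → sgn m * oneMinusX m ≡ + ((fall 1 m / m !) {{m !≢0}})
  sgn-*-oneMinusX zero          = refl
  sgn-*-oneMinusX (suc zero)    = refl
  sgn-*-oneMinusX m@(suc (suc j)) = begin
    sgn m * + 0                           ≡⟨ ℤP.*-zeroʳ (sgn m) ⟩
    + 0                                   ≡⟨ cong +_ (0/n≡0 (m !) {{m !≢0}}) ⟨
    + ((0 / m !) {{m !≢0}})               ≡⟨ cong (λ n → + ((n / m !) {{m !≢0}})) fall1≡0 ⟨
    + ((fall 1 m / m !) {{m !≢0}})        ∎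
    where
    fall1≡0 : fall 1 m ≡ 0
    fall1≡0 = trans (cong (fall 1 (suc j) ℕ.*_) (ℕP.0∸n≡0 j)) (ℕP.*-zeroʳ (fall 1 (suc j)))

  signedMultinom-regroup : ∀ p q →
    sgn (numParts p ℕ.+ numParts q) * + multinom p * + multinom q * + N p q
      ≡ signedMultinom q * (signedMultinom p * + N p q)
  signedMultinom-regroup p q rewrite sgn-+ (numParts p) (numParts q) =
    solve 5 (λ sp sq mp mq n → sp :* sq :* mp :* mq :* n := (sq :* mq) :* ((sp :* mp) :* n)) refl
      (sgn (numParts p)) (sgn (numParts q)) (+ multinom p) (+ multinom q) (+ N p q)
    where open +-*-Solver

  ∑∑-sgn-multinom-N : ∀ {m ps} → Enumerates m ps →
    ∑[ p ∈ ps ] ∑[ q ∈ ps ] (sgn (numParts p ℕ.+ numParts q) * + multinom p * + multinom q * + N p q)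
      ≡ + ((fall 1 m / m !) {{m !≢0}})
  ∑∑-sgn-multinom-N {m} {ps} enum =
    trans (∑-cong ps (λ {p} _ → ∑-cong ps (λ {q} _ → signedMultinom-regroup p q)))
          (trans (∑∑-signedMultinom-N enum) (sgn-*-oneMinusX m))

open SignedSums

corollary1 : (m : ℕ) (ps : List (List ℕ))
    → Unique ps
    → (∀ p → p ∈ ps → p ⊢ m)
    → (∀ p → p ⊢ m → p ∈ ps)
    → ((q : List ℕ) → q ⊢ m
         → sumℤ (L.map (λ p → sgn (numParts p) ℤ.* (ℤ.+ multinom p) ℤ.* (ℤ.+ N p q)) ps)
           ≡ sgn m)
      × (sumℤ (L.map (λ p → sumℤ (L.map (λ q →
            sgn (numParts p ℕ.+ numParts q) ℤ.* (ℤ.+ multinom p) ℤ.* (ℤ.+ multinom q)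
              ℤ.* (ℤ.+ N p q)) ps)) ps)
         ≡ ℤ.+ ((fall 1 m / (m !)) {{m !≢0}}))
corollary1 m ps unique sound complete =
  (λ q q⊢m → weightedSum-N≡sgn m (<-wellFounded m) enum q (proj₁ q⊢m)) , ∑∑-sgn-multinom-N enum
  where
  enum : Enumerates m ps
  enum = unique , sound , complete
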